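{- Let $G=(V,E)$ be a semi-repeat-free elastic founder graph, and let $(v,w)\in E$. Then the string $\ell(v)\ell(w)$ occurs in $G$ only as a prefix of (labels of) paths starting with $v$.
   Context: An elastic founder graph $G=(V,E,\ell)$ is induced by a segmentation of a (gapped) multiple sequence alignment into consecutive column intervals: block $k$ has one node per distinct gap-free row string $\mathrm{spell}(\mathrm{MSA}[i,x_k..y_k])$ (all required non-empty), labeled by it, and $(v,w)\in E$ iff $v,w$ lie in consecutive blocks $k,k+1$ and some row $t$ satisfies $\mathrm{spell}(\mathrm{MSA}[t,x_k..y_{k+1}])=\ell(v)\ell(w)$, where $\mathrm{spell}$ removes gap symbols. The label of a path is the concatenation of its node labels; a string occurs in $G$ if it is a substring of some path label. $G$ is semi-repeat-free if for every $v\in V$, every occurrence of $\ell(v)$ in $G$ is a prefix of the label of a path starting at a node $w$ in the same block as $v$. -}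

module Defs where

open import Data.Nat using (ℕ; suc; _<_; _∸_)
open import Data.Fin using (Fin; zero; suc; toℕ; inject₁; fromℕ)
open import Data.Maybe using (Maybe)
open import Data.List using (List; []; _∷_; _++_; concat; map; take; drop; catMaybes)
open import Data.Vec using (Vec; toList)
open import Data.Product using (Σ; ∃; ∃-syntax; _×_; _,_; proj₁; proj₂)
open import Data.List.Relation.Unary.All using (All)
open import Data.List.Relation.Unary.Linked using (Linked)
open import Relation.Binary.PropositionalEquality using (_≡_; _≢_)

-- Gapped symbols: `nothing` is the gap symbol '-', `just a` is a letter a.
-- spell removes gaps.
spell : {A : Set} → List (Maybe A) → List A
spell = catMaybes

slice : {A : Set} {n : ℕ} → ℕ → ℕ → Vec (Maybe A) n → List (Maybe A)
slice x y r = take (y ∸ x) (drop x (toList r))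

-- The elastic founder graph induced by an MSA `M` with m rows and n columns
-- and a segmentation into b blocks given by boundaries bd 0 < bd 1 < ... < bd b,
-- block k (k : Fin b) being the column interval [bd k, bd (k+1)).
module EFG {A : Set} {m n : ℕ} (M : Fin m → Vec (Maybe A) n)
           (b : ℕ) (bd : Fin (suc b) → ℕ) where

  blockStr : Fin m → Fin b → List A
  blockStr t k = spell (slice (bd (inject₁ k)) (bd (suc k)) (M t))

  ValidSegmentation : Set
  ValidSegmentation =
    (bd zero ≡ 0) × (bd (fromℕ b) ≡ n) ×
    (∀ (k : Fin b) → bd (inject₁ k) < bd (suc k)) ×
    (∀ (t : Fin m) (k : Fin b) → blockStr t k ≢ [])

  -- A node is identified by its block and its label (one node per distinct
  -- string in a block).
  Node : Set
  Node = Fin b × List A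

  block : Node → Fin b
  block = proj₁

  ℓ : Node → List A
  ℓ = proj₂

  InV : Node → Set
  InV (k , s) = ∃[ t ] blockStr t k ≡ s

  Edge : Node → Node → Set
  Edge v w = InV v × InV w × (toℕ (block w) ≡ suc (toℕ (block v))) ×
    (∃[ t ] spell (slice (bd (inject₁ (block v))) (bd (suc (block w))) (M t))
              ≡ ℓ v ++ ℓ w)

  IsPath : List Node → Set
  IsPath P = All InV P × Linked Edge P

  label : List Node → List A
  label P = concat (map ℓ P)

  -- Every occurrence of ℓ(v) in G (i.e. every decomposition
  -- label(P) = x ++ ℓ(v) ++ y of the label of a path P) starts exactly at a
  -- node u of P lying in the block of v (so ℓ(v) is a prefix of the label of
  -- the subpath starting at u).
  SemiRepeatFree : Set
  SemiRepeatFree =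
    ∀ (v : Node) → InV v →
    ∀ (P : List Node) → IsPath P →
    ∀ (x y : List A) → label P ≡ x ++ ℓ v ++ y →
    ∃[ P₁ ] ∃[ u ] ∃[ P₂ ]
      (P ≡ P₁ ++ u ∷ P₂) × (label P₁ ≡ x) × (block u ≡ block v)

{-# OPTIONS --safe #-}
module Submission where

-- Semi-repeat-freeness applied to v and to w places the occurrences of ℓ(v)
-- and ℓ(w) at nodes u and u' of the path, in the blocks of v and w.  Blocks
-- increase by exactly one along a path and block(w) = block(v) + 1, so u' is
-- the node right after u; hence the occurrence of ℓ(w) starts where ℓ(u)
-- ends, which forces ℓ(u) = ℓ(v), and so u = v.

open import Defs
open import Data.Nat using (ℕ; suc; _+_)
open import Data.Nat.Properties using (+-suc; suc-injective; 1+n≢n; m≢1+n+m; m+1+n≢n)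
open import Data.Fin using (Fin; toℕ)
open import Data.Maybe using (Maybe)
open import Data.List using (List; []; _∷_; _++_; [_]; length)
open import Data.List.Properties using (∷-injective; ++-assoc; ++-cancelˡ; concatMap-++; ++-identityʳ)
open import Data.List.Relation.Unary.Linked using (Linked; _∷_; tail)
open import Data.Vec using (Vec)
open import Data.Product using (∃-syntax; _×_; _,_)
open import Data.Empty using (⊥-elim)
open import Relation.Binary.PropositionalEquality using (_≡_; refl; sym; trans; cong; cong₂; module ≡-Reasoning)
open ≡-Reasoning

module Graded {N : Set} (rank : N → ℕ) (R : N → N → Set)
              (rank-step : ∀ {a c} → R a c → rank c ≡ suc (rank a)) where

  rank-distance : ∀ a L c L' → Linked R (a ∷ L ++ c ∷ L') →
                  rank c ≡ suc (length L + rank a)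
  rank-distance a []      c L' (r ∷ _)    = rank-step r
  rank-distance a (d ∷ L) c L' (r ∷ rest) = begin
    rank c                         ≡⟨ rank-distance d L c L' rest ⟩
    suc (length L + rank d)        ≡⟨ cong (λ k → suc (length L + k)) (rank-step r) ⟩
    suc (length L + suc (rank a))  ≡⟨ cong suc (+-suc (length L) (rank a)) ⟩
    suc (suc (length L + rank a))  ∎

  successor-follows : ∀ {xs} P u Q P' u' Q' → Linked R xs →
                      xs ≡ P ++ u ∷ Q → xs ≡ P' ++ u' ∷ Q' →
                      rank u' ≡ suc (rank u) → P' ≡ P ++ [ u ]
  successor-follows [] u Q [] u' Q' _ refl refl u'-next =
    ⊥-elim (1+n≢n (sym u'-next))
  successor-follows [] u Q (q ∷ []) u' Q' _ refl refl _ = refl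
  successor-follows [] u Q (q ∷ r ∷ P') u' Q' linked refl refl u'-next =
    ⊥-elim (m≢1+n+m (rank u)
      (suc-injective (trans (sym u'-next) (rank-distance u (r ∷ P') u' Q' linked))))
  successor-follows (p ∷ P) u Q [] u' Q' linked refl refl u'-next =
    ⊥-elim (m+1+n≢n (suc (length P))
      (sym (trans (rank-distance p P u Q linked) (cong (λ k → suc (length P + k)) u'-next))))
  successor-follows (p ∷ P) u Q (q ∷ P') u' Q' linked refl eq' u'-next
    with refl , eq ← ∷-injective eq' =
    cong (p ∷_) (successor-follows P u Q P' u' Q' (tail linked) refl eq u'-next)

module FounderGraph {A : Set} {m n : ℕ} (M : Fin m → Vec (Maybe A) n)
                    (b : ℕ) (bd : Fin (suc b) → ℕ) where
  open EFG M b bd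

  blockIndex : Node → ℕ
  blockIndex v = toℕ (block v)

  blockIndex-step : ∀ {v w} → Edge v w → blockIndex w ≡ suc (blockIndex v)
  blockIndex-step (_ , _ , w-after-v , _) = w-after-v

  open Graded blockIndex Edge blockIndex-step public

  label-∷ʳ : ∀ P u → label (P ++ [ u ]) ≡ label P ++ ℓ u
  label-∷ʳ P u = begin
    label (P ++ [ u ])       ≡⟨ concatMap-++ ℓ P [ u ] ⟩
    label P ++ ℓ u ++ []     ≡⟨ cong (label P ++_) (++-identityʳ (ℓ u)) ⟩
    label P ++ ℓ u           ∎

lemma10 : {A : Set} {m n : ℕ} (M : Fin m → Vec (Maybe A) n) (b : ℕ) (bd : Fin (suc b) → ℕ) →
    EFG.ValidSegmentation M b bd →
    EFG.SemiRepeatFree M b bd →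
    ∀ (v w : EFG.Node M b bd) → EFG.Edge M b bd v w →
    ∀ (P : List (EFG.Node M b bd)) → EFG.IsPath M b bd P →
    ∀ (x y : List A) → EFG.label M b bd P ≡ x ++ (EFG.ℓ M b bd v ++ EFG.ℓ M b bd w) ++ y →
    ∃[ P₁ ] ∃[ P₂ ] (P ≡ P₁ ++ v ∷ P₂) × (EFG.label M b bd P₁ ≡ x)
lemma10 M b bd _ srf v w (v∈V , w∈V , w-after-v , _) P P-path@(_ , P-linked) x y P≡xvwy
  with srf v v∈V P P-path x (ℓ w ++ y) occurrence-v
     | srf w w∈V P P-path (x ++ ℓ v) y occurrence-w
  where
  open EFG M b bd
  occurrence-v : label P ≡ x ++ ℓ v ++ ℓ w ++ y
  occurrence-v = trans P≡xvwy (cong (x ++_) (++-assoc (ℓ v) (ℓ w) y))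
  occurrence-w : label P ≡ (x ++ ℓ v) ++ ℓ w ++ y
  occurrence-w = trans occurrence-v (sym (++-assoc x (ℓ v) (ℓ w ++ y)))
... | P₁ , u , P₂ , P≡P₁uP₂ , label-P₁ , u-in-block-v
    | Q₁ , u' , Q₂ , P≡Q₁u'Q₂ , label-Q₁ , u'-in-block-w =
  P₁ , P₂ , trans P≡P₁uP₂ (cong (λ z → P₁ ++ z ∷ P₂) u≡v) , label-P₁
  where
  open EFG M b bd
  open FounderGraph M b bd
  Q₁≡P₁u : Q₁ ≡ P₁ ++ [ u ]
  Q₁≡P₁u = successor-follows P₁ u P₂ Q₁ u' Q₂ P-linked P≡P₁uP₂ P≡Q₁u'Q₂ (begin
    blockIndex u'           ≡⟨ cong toℕ u'-in-block-w ⟩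
    blockIndex w            ≡⟨ w-after-v ⟩
    suc (blockIndex v)      ≡⟨ cong (λ k → suc (toℕ k)) u-in-block-v ⟨
    suc (blockIndex u)      ∎)
  ℓu≡ℓv : ℓ u ≡ ℓ v
  ℓu≡ℓv = ++-cancelˡ x (ℓ u) (ℓ v) (begin
    x ++ ℓ u                ≡⟨ cong (_++ ℓ u) label-P₁ ⟨
    label P₁ ++ ℓ u         ≡⟨ label-∷ʳ P₁ u ⟨
    label (P₁ ++ [ u ])     ≡⟨ cong label Q₁≡P₁u ⟨
    label Q₁                ≡⟨ label-Q₁ ⟩
    x ++ ℓ v                ∎)
  u≡v : u ≡ v
  u≡v = cong₂ _,_ u-in-block-v ℓu≡ℓv
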